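{- Let $n\ge 6$. The number of periodic strings in $\mathbf{A}(n)$ is less than or equal to the number of aperiodic strings in $\mathbf{A}(n)$.
   Context: A binary string $\alpha$ is periodic if $\alpha=\gamma^j$ for some nonempty $\gamma$ and $j>1$, and aperiodic otherwise. Binary strings are compared lexicographically with $0<1$ (a proper prefix is smaller). For $\alpha=a_1\cdots a_n$, $\alpha^R=a_n\cdots a_1$. $[\alpha]$ is the set of rotations of $\alpha$; $\alpha$ is a necklace if it is lexicographically smallest in $[\alpha]$, and a bracelet if lexicographically smallest in $[\alpha]\cup[\alpha^R]$. A necklace $\alpha$ is symmetric if $\alpha^R\in[\alpha]$, otherwise asymmetric. $\mathbf{A}(n)$ is the set of length-$n$ asymmetric bracelets. -}

module Defs where

open import Data.Bool using (Bool; true; false)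
open import Data.Nat using (ℕ; _<_; _>_)
open import Data.List using (List; []; _∷_; _++_; length; take; drop; reverse; concat; replicate)
open import Data.List.Relation.Unary.Unique.Propositional using (Unique)
open import Data.List.Membership.Propositional using (_∈_)
open import Data.Product using (Σ; _×_; ∃)
open import Data.Sum using (_⊎_)
open import Relation.Nullary using (¬_)
open import Relation.Binary.PropositionalEquality using (_≡_)

-- Binary strings: lists of bits, false = 0, true = 1.
BStr : Set
BStr = List Bool

data _<ₗ_ : BStr → BStr → Set where
  []<∷  : ∀ {b bs} → [] <ₗ (b ∷ bs)
  0<1   : ∀ {xs ys} → (false ∷ xs) <ₗ (true ∷ ys)
  step  : ∀ {b xs ys} → xs <ₗ ys → (b ∷ xs) <ₗ (b ∷ ys)

_≤ₗ_ : BStr → BStr → Set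
x ≤ₗ y = (x ≡ y) ⊎ (x <ₗ y)

rotate : ℕ → BStr → BStr
rotate i α = drop i α ++ take i α

IsRotation : BStr → BStr → Set
IsRotation β α = Σ ℕ λ i → (i < length α) × (β ≡ rotate i α)

Necklace : BStr → Set
Necklace α = ∀ β → IsRotation β α → α ≤ₗ β

Bracelet : BStr → Set
Bracelet α = ∀ β → (IsRotation β α ⊎ IsRotation β (reverse α)) → α ≤ₗ β

Symmetric : BStr → Set
Symmetric α = IsRotation (reverse α) α

Periodic : BStr → Set
Periodic α = Σ BStr λ γ → Σ ℕ λ j → (length γ > 0) × (j > 1) × (α ≡ concat (replicate j γ))

Aperiodic : BStr → Set
Aperiodic α = ¬ Periodic α

-- α ∈ A(n): a length-n asymmetric bracelet (a bracelet is a necklace;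
-- asymmetric means the necklace is not symmetric).
InA : ℕ → BStr → Set
InA n α = (length α ≡ n) × Bracelet α × Necklace α × ¬ Symmetric α

HasCount : (BStr → Set) → ℕ → Set
HasCount P k = Σ (List BStr) λ xs → Unique xs × (∀ α → α ∈ xs → P α) × (∀ α → P α → α ∈ xs) × (length xs ≡ k)

-- Write a periodic α ∈ A(n) as γ^j with j ≥ 2 and γ = 0^k u, where u starts with 1.
-- Being a necklace, α has no run of k+1 zeros, so u also ends with 1; and u is not a
-- palindrome, since otherwise α^R would be a rotation of α.  Hence |u| ≥ 4, so that
-- M = n − |γ| − 2 exceeds k+1 and the leading 0^M is the only run of M zeros in
-- s = 0^M T with T = 1 0 γ, while T is smaller than T^R.  Every nontrivial rotation of s,
-- and every rotation of s^R other than 0^M T^R, starts with fewer than M zeros followed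
-- by a 1, so s is an aperiodic asymmetric bracelet of length n.  As γ can be read off s
-- and determines α, the map α ↦ s is injective.
module Submission where

open import Defs
open import Data.Bool using (true; false)
open import Data.Nat using (ℕ; zero; suc; _+_; _*_; _∸_; _≤_; _<_; z≤n; s≤s; >-nonZero)
open import Data.Nat.Properties
open import Data.List using (List; []; _∷_; _++_; _∷ʳ_; length; take; drop; reverse; concat; replicate; initLast; _∷ʳ′_)
open import Data.List.Properties
open import Data.List.Relation.Unary.Unique.Propositional using (Unique)
open import Data.List.Relation.Unary.AllPairs using ([]; _∷_)
open import Data.List.Relation.Unary.All using (lookup)
open import Data.List.Relation.Unary.Any using (here; there)
open import Data.List.Membership.Propositional using (_∈_)
open import Data.List.Membership.Propositional.Properties using (∈-∃++)
open import Data.Product using (_×_; ∃; ∃₂; _,_; proj₁; proj₂)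
open import Data.Sum using (inj₁; inj₂)
open import Data.Empty using (⊥-elim)
open import Relation.Nullary using (¬_; yes; no; contradiction)
open import Relation.Binary.PropositionalEquality

module _ {A B : Set} where

  ∈-++-∷⁻ : ∀ {a b : B} ys zs → a ∈ ys ++ b ∷ zs → a ≢ b → a ∈ ys ++ zs
  ∈-++-∷⁻ []       zs (here a≡b) a≢b = ⊥-elim (a≢b a≡b)
  ∈-++-∷⁻ []       zs (there a∈) _   = a∈
  ∈-++-∷⁻ (y ∷ ys) zs (here a≡y) _   = here a≡y
  ∈-++-∷⁻ (y ∷ ys) zs (there a∈) a≢b = there (∈-++-∷⁻ ys zs a∈ a≢b)

  length-≤-injection : ∀ (xs : List A) (ys : List B) → Unique xs →
    (f : ∀ x → x ∈ xs → B) → (∀ x x∈ → f x x∈ ∈ ys) →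
    (∀ {x y} x∈ y∈ → f x x∈ ≡ f y y∈ → x ≡ y) → length xs ≤ length ys
  length-≤-injection []       ys _              f f∈ f-inj = z≤n
  length-≤-injection (x ∷ xs) ys (x∉xs ∷ xs-uniq) f f∈ f-inj
    with ys₁ , ys₂ , refl ← ∈-∃++ (f∈ x (here refl)) =
    subst (suc (length xs) ≤_) (sym (length-++-sucʳ ys₁ _ ys₂))
      (s≤s (length-≤-injection xs (ys₁ ++ ys₂) xs-uniq f′ f′∈ (λ x∈ y∈ → f-inj (there x∈) (there y∈))))
    where
    f′ : ∀ z → z ∈ xs → B
    f′ z z∈ = f z (there z∈)
    f′∈ : ∀ z z∈ → f′ z z∈ ∈ ys₁ ++ ys₂
    f′∈ z z∈ = ∈-++-∷⁻ ys₁ ys₂ (f∈ z (there z∈))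
                 (λ e → lookup x∉xs z∈ (sym (f-inj (there z∈) (here refl) e)))

HasCount-≤ : ∀ {P Q : BStr → Set} {p q} (f : ∀ α → P α → BStr) → (∀ α a → Q (f α a)) →
  (∀ {α β} a b → f α a ≡ f β b → α ≡ β) → HasCount P p → HasCount Q q → p ≤ q
HasCount-≤ f f-Q f-inj (xs , xs-uniq , xs⊆P , _ , refl) (ys , _ , _ , Q⊆ys , refl) =
  length-≤-injection xs ys xs-uniq (λ α α∈ → f α (xs⊆P α α∈)) (λ α α∈ → Q⊆ys _ (f-Q α _))
    (λ α∈ β∈ → f-inj (xs⊆P _ α∈) (xs⊆P _ β∈))

module _ {A : Set} where

  drop-length+-++ : ∀ (xs ys : List A) i → drop (length xs + i) (xs ++ ys) ≡ drop i ys
  drop-length+-++ []       ys i = refl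
  drop-length+-++ (x ∷ xs) ys i = drop-length+-++ xs ys i

  take-length+-++ : ∀ (xs ys : List A) i → take (length xs + i) (xs ++ ys) ≡ xs ++ take i ys
  take-length+-++ []       ys i = refl
  take-length+-++ (x ∷ xs) ys i = cong (x ∷_) (take-length+-++ xs ys i)

  drop-≤-++ : ∀ i (xs ys : List A) → i ≤ length xs → drop i (xs ++ ys) ≡ drop i xs ++ ys
  drop-≤-++ zero    xs       ys _       = refl
  drop-≤-++ (suc i) (x ∷ xs) ys (s≤s p) = drop-≤-++ i xs ys p

  drop-<-≢[] : ∀ i (xs : List A) → i < length xs → drop i xs ≢ []
  drop-<-≢[] zero    (x ∷ xs) _       ()
  drop-<-≢[] (suc i) (x ∷ xs) (s≤s p) = drop-<-≢[] i xs p

rotate-length+-++ : ∀ (xs ys : BStr) i → rotate (length xs + i) (xs ++ ys) ≡ drop i ys ++ xs ++ take i ys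
rotate-length+-++ xs ys i = cong₂ _++_ (drop-length+-++ xs ys i) (take-length+-++ xs ys i)

rotate-length-++ : ∀ (xs ys : BStr) → rotate (length xs) (xs ++ ys) ≡ ys ++ xs
rotate-length-++ xs ys = begin
  rotate (length xs) (xs ++ ys)     ≡⟨ cong (λ i → rotate i (xs ++ ys)) (sym (+-identityʳ (length xs))) ⟩
  rotate (length xs + 0) (xs ++ ys) ≡⟨ rotate-length+-++ xs ys 0 ⟩
  ys ++ xs ++ []                    ≡⟨ cong (ys ++_) (++-identityʳ xs) ⟩
  ys ++ xs                          ∎
  where open ≡-Reasoning

IsRotation-sym : ∀ {α β : BStr} → IsRotation β α → IsRotation α β
IsRotation-sym {α} (zero , 0<α , refl) =
  0 , subst (0 <_) (sym (length-++ α {[]})) (<-≤-trans 0<α (m≤m+n _ 0)) ,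
  sym (trans (++-identityʳ _) (++-identityʳ α))
IsRotation-sym {α} (suc i , i<α , refl) =
  length (drop (suc i) α) , length-drop<length , sym rotate-back
  where
  length-drop<length : length (drop (suc i) α) < length (drop (suc i) α ++ take (suc i) α)
  length-drop<length = begin-strict
    length (drop (suc i) α)                   ≡⟨ length-drop (suc i) α ⟩
    length α ∸ suc i                          <⟨ ∸-monoʳ-< (s≤s z≤n) (<⇒≤ i<α) ⟩
    length α                                  ≡⟨ cong length (sym (take++drop≡id (suc i) α)) ⟩
    length (take (suc i) α ++ drop (suc i) α) ≡⟨ length-++-comm (take (suc i) α) _ ⟩
    length (drop (suc i) α ++ take (suc i) α) ∎
    where open ≤-Reasoning
  rotate-back : rotate (length (drop (suc i) α)) (drop (suc i) α ++ take (suc i) α) ≡ α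
  rotate-back = trans (rotate-length-++ (drop (suc i) α) _) (take++drop≡id (suc i) α)

zeros : ℕ → BStr
zeros c = replicate c false

zeros-+ : ∀ a b → zeros (a + b) ≡ zeros a ++ zeros b
zeros-+ zero    b = refl
zeros-+ (suc a) b = cong (false ∷_) (zeros-+ a b)

zeros-≤ : ∀ {a b} → a ≤ b → ∃ λ o → zeros b ≡ zeros a ++ zeros o
zeros-≤ {a} a≤b with o , refl ← m≤n⇒∃[o]m+o≡n a≤b = o , zeros-+ a o

zeros-suc : ∀ c → zeros (suc c) ≡ zeros c ∷ʳ false
zeros-suc zero    = refl
zeros-suc (suc c) = cong (false ∷_) (zeros-suc c)

reverse-zeros : ∀ c → reverse (zeros c) ≡ zeros c
reverse-zeros zero    = refl
reverse-zeros (suc c) = begin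
  reverse (false ∷ zeros c) ≡⟨ unfold-reverse false (zeros c) ⟩
  reverse (zeros c) ∷ʳ false ≡⟨ cong (_∷ʳ false) (reverse-zeros c) ⟩
  zeros c ∷ʳ false          ≡⟨ zeros-suc c ⟨
  zeros (suc c)             ∎
  where open ≡-Reasoning

drop-zeros : ∀ i c → drop i (zeros c) ≡ zeros (c ∸ i)
drop-zeros zero    c       = refl
drop-zeros (suc i) zero    = refl
drop-zeros (suc i) (suc c) = drop-zeros i c

zeros-one-injective : ∀ a b {x y} → zeros a ++ true ∷ x ≡ zeros b ++ true ∷ y → x ≡ y
zeros-one-injective zero    zero    e = ∷-injectiveʳ e
zeros-one-injective (suc a) (suc b) e = zeros-one-injective a b (∷-injectiveʳ e)

data LeadingZeros : BStr → Set where
  all-zeros : ∀ c → LeadingZeros (zeros c)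
  zeros-one : ∀ c r → LeadingZeros (zeros c ++ true ∷ r)

leadingZeros : ∀ z → LeadingZeros z
leadingZeros []          = all-zeros 0
leadingZeros (true ∷ z)  = zeros-one 0 z
leadingZeros (false ∷ z) with leadingZeros z
... | all-zeros c  = all-zeros (suc c)
... | zeros-one c r = zeros-one (suc c) r

infixr 8 _^_

_^_ : BStr → ℕ → BStr
γ ^ j = concat (replicate j γ)

^-comm : ∀ γ j → γ ^ j ++ γ ≡ γ ++ γ ^ j
^-comm γ zero    = sym (++-identityʳ γ)
^-comm γ (suc j) = trans (++-assoc γ (γ ^ j) γ) (cong (γ ++_) (^-comm γ j))

length-^ : ∀ γ j → length (γ ^ j) ≡ j * length γ
length-^ γ zero    = refl
length-^ γ (suc j) = trans (length-++ γ) (cong (length γ +_) (length-^ γ j))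

reverse-^ : ∀ γ j → reverse (γ ^ j) ≡ reverse γ ^ j
reverse-^ γ zero    = refl
reverse-^ γ (suc j) = begin
  reverse (γ ++ γ ^ j)             ≡⟨ reverse-++ γ (γ ^ j) ⟩
  reverse (γ ^ j) ++ reverse γ     ≡⟨ cong (_++ reverse γ) (reverse-^ γ j) ⟩
  reverse γ ^ j ++ reverse γ       ≡⟨ ^-comm (reverse γ) j ⟩
  reverse γ ++ reverse γ ^ j       ∎
  where open ≡-Reasoning

^-rotate : ∀ x y j → (x ++ (y ++ x) ^ j) ++ y ≡ (x ++ y) ^ suc j
^-rotate x y zero    = trans (cong (_++ y) (++-identityʳ x)) (sym (++-identityʳ (x ++ y)))
^-rotate x y (suc j) = begin
  (x ++ (y ++ x) ++ (y ++ x) ^ j) ++ y ≡⟨ cong (λ t → (x ++ t) ++ y) (++-assoc y x _) ⟩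
  (x ++ y ++ x ++ (y ++ x) ^ j) ++ y   ≡⟨ ++-assoc x _ y ⟩
  x ++ (y ++ x ++ (y ++ x) ^ j) ++ y   ≡⟨ cong (x ++_) (++-assoc y _ y) ⟩
  x ++ y ++ (x ++ (y ++ x) ^ j) ++ y   ≡⟨ ++-assoc x y _ ⟨
  (x ++ y) ++ (x ++ (y ++ x) ^ j) ++ y ≡⟨ cong ((x ++ y) ++_) (^-rotate x y j) ⟩
  (x ++ y) ++ (x ++ y) ^ suc j         ∎
  where open ≡-Reasoning

^-cancel-length : ∀ γ i j → 0 < length γ → length (γ ^ i) ≡ length (γ ^ j) → i ≡ j
^-cancel-length γ i j 0<γ e =
  *-cancelʳ-≡ i j (length γ) {{>-nonZero 0<γ}} (trans (sym (length-^ γ i)) (trans e (length-^ γ j)))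

<ₗ-irrefl : ∀ {x} → ¬ (x <ₗ x)
<ₗ-irrefl (step p) = <ₗ-irrefl p

++-monoʳ-<ₗ : ∀ P {a b} → a <ₗ b → (P ++ a) <ₗ (P ++ b)
++-monoʳ-<ₗ []      a<b = a<b
++-monoʳ-<ₗ (x ∷ P) a<b = step (++-monoʳ-<ₗ P a<b)

zeros-<ₗ-zeros-one : ∀ {c M} T b → c < M → (zeros M ++ T) <ₗ (zeros c ++ true ∷ b)
zeros-<ₗ-zeros-one {zero}  {suc M} T b _       = 0<1
zeros-<ₗ-zeros-one {suc c} {suc M} T b (s≤s p) = step (zeros-<ₗ-zeros-one T b p)

zeros-one-≰ₗ-zeros-zero : ∀ c {a b} → ¬ (zeros c ++ true ∷ a) ≤ₗ (zeros c ++ false ∷ b)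
zeros-one-≰ₗ-zeros-zero zero    (inj₁ ())
zeros-one-≰ₗ-zeros-zero zero    (inj₂ ())
zeros-one-≰ₗ-zeros-zero (suc c) (inj₁ e)        = zeros-one-≰ₗ-zeros-zero c (inj₁ (∷-injectiveʳ e))
zeros-one-≰ₗ-zeros-zero (suc c) (inj₂ (step p)) = zeros-one-≰ₗ-zeros-zero c (inj₂ p)

HasZeroRun : ℕ → BStr → Set
HasZeroRun M z = ∃₂ λ x y → z ≡ x ++ zeros M ++ y

EndsInOne : BStr → Set
EndsInOne w = ∃ λ w′ → w ≡ w′ ∷ʳ true

endsInOne-++ : ∀ p {w} → EndsInOne w → EndsInOne (p ++ w)
endsInOne-++ p (w′ , refl) = p ++ w′ , sym (++-assoc p w′ _)

hasZeroRun-≤ : ∀ {a M z} → a ≤ M → HasZeroRun M z → HasZeroRun a z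
hasZeroRun-≤ {a} a≤M (x , y , refl) with o , e ← zeros-≤ a≤M =
  x , zeros o ++ y , cong (x ++_) (trans (cong (_++ y) e) (++-assoc (zeros a) (zeros o) y))

hasZeroRun-infix : ∀ {M} p v q → HasZeroRun M v → HasZeroRun M (p ++ v ++ q)
hasZeroRun-infix {M} p v q (x , y , refl) = p ++ x , y ++ q , run
  where
  open ≡-Reasoning
  run : p ++ (x ++ zeros M ++ y) ++ q ≡ (p ++ x) ++ zeros M ++ y ++ q
  run = begin
    p ++ (x ++ zeros M ++ y) ++ q ≡⟨ cong (p ++_) (++-assoc x _ q) ⟩
    p ++ x ++ (zeros M ++ y) ++ q ≡⟨ cong (λ t → p ++ x ++ t) (++-assoc (zeros M) y q) ⟩
    p ++ x ++ zeros M ++ y ++ q   ≡⟨ ++-assoc p x _ ⟨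
    (p ++ x) ++ zeros M ++ y ++ q ∎

hasZeroRun-reverse : ∀ {M} z → HasZeroRun M z → HasZeroRun M (reverse z)
hasZeroRun-reverse {M} z (x , y , refl) = reverse y , reverse x , run
  where
  open ≡-Reasoning
  run : reverse (x ++ zeros M ++ y) ≡ reverse y ++ zeros M ++ reverse x
  run = begin
    reverse (x ++ zeros M ++ y)                   ≡⟨ reverse-++ x _ ⟩
    reverse (zeros M ++ y) ++ reverse x           ≡⟨ cong (_++ reverse x) (reverse-++ (zeros M) y) ⟩
    (reverse y ++ reverse (zeros M)) ++ reverse x ≡⟨ cong (λ t → (reverse y ++ t) ++ reverse x) (reverse-zeros M) ⟩
    (reverse y ++ zeros M) ++ reverse x           ≡⟨ ++-assoc (reverse y) (zeros M) _ ⟩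
    reverse y ++ zeros M ++ reverse x             ∎

¬hasZeroRun-reverse : ∀ {M} z → ¬ HasZeroRun M z → ¬ HasZeroRun M (reverse z)
¬hasZeroRun-reverse {M} z free run =
  free (subst (HasZeroRun M) (reverse-involutive z) (hasZeroRun-reverse (reverse z) run))

zeros-one-≢-zeros : ∀ {M} a {v y} → a < M → zeros a ++ true ∷ v ≢ zeros M ++ y
zeros-one-≢-zeros {suc M} zero    _       ()
zeros-one-≢-zeros {suc M} (suc a) (s≤s p) e = zeros-one-≢-zeros a p (∷-injectiveʳ e)

hasZeroRun-zeros-one-++⁻ : ∀ {M} a x {v y} → a < M →
  zeros a ++ true ∷ v ≡ x ++ zeros M ++ y → HasZeroRun M v
hasZeroRun-zeros-one-++⁻ a       []      a<M e = ⊥-elim (zeros-one-≢-zeros a a<M e)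
hasZeroRun-zeros-one-++⁻ zero    (b ∷ x) _   e = x , _ , ∷-injectiveʳ e
hasZeroRun-zeros-one-++⁻ (suc a) (b ∷ x) a<M e =
  hasZeroRun-zeros-one-++⁻ a x (<-trans (n<1+n a) a<M) (∷-injectiveʳ e)

¬hasZeroRun-zeros-one-++ : ∀ {M} a {v} → a < M → ¬ HasZeroRun M v → ¬ HasZeroRun M (zeros a ++ true ∷ v)
¬hasZeroRun-zeros-one-++ a a<M free (x , y , e) = free (hasZeroRun-zeros-one-++⁻ a x a<M e)

-- The final 1 of w keeps a suffix from consisting of zeros only.
suffix-short-leading-zeros : ∀ {M w} → EndsInOne w → ¬ HasZeroRun M w → ∀ p z → w ≡ p ++ z → z ≢ [] →
  ∃₂ λ c z′ → c < M × z ≡ zeros c ++ true ∷ z′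
suffix-short-leading-zeros {M} (w′ , refl) free p z e z≢[] with leadingZeros z
... | all-zeros zero    = ⊥-elim (z≢[] refl)
... | all-zeros (suc c) = ⊥-elim (true≢false (∷ʳ-injectiveʳ w′ (p ++ zeros c) (begin
  w′ ∷ʳ true              ≡⟨ e ⟩
  p ++ zeros (suc c)      ≡⟨ cong (p ++_) (zeros-suc c) ⟩
  p ++ zeros c ∷ʳ false   ≡⟨ ++-assoc p (zeros c) _ ⟨
  (p ++ zeros c) ∷ʳ false ∎)))
  where
  open ≡-Reasoning
  true≢false : true ≢ false
  true≢false ()
... | zeros-one c r with c <? M
...   | yes c<M = c , r , c<M , refl
...   | no  c≮M = ⊥-elim (free (hasZeroRun-≤ (≮⇒≥ c≮M) (p , true ∷ r , e)))

necklace⇒¬hasZeroRun : ∀ k t → Necklace (zeros k ++ true ∷ t) → ¬ HasZeroRun (suc k) (zeros k ++ true ∷ t)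
necklace⇒¬hasZeroRun k t necklace (x , y , e) =
  zeros-one-≰ₗ-zeros-zero k (subst ((zeros k ++ true ∷ t) ≤ₗ_) rotation-has-k+1-zeros
    (necklace _ (length x , x<α , refl)))
  where
  x<α : length x < length (zeros k ++ true ∷ t)
  x<α = subst (length x <_) (sym (trans (cong length e) (length-++ x))) (m<m+n (length x) (s≤s z≤n))
  rotation-has-k+1-zeros : rotate (length x) (zeros k ++ true ∷ t) ≡ zeros k ++ false ∷ (y ++ x)
  rotation-has-k+1-zeros = begin
    rotate (length x) (zeros k ++ true ∷ t)     ≡⟨ cong (rotate (length x)) e ⟩
    rotate (length x) (x ++ zeros (suc k) ++ y) ≡⟨ rotate-length-++ x _ ⟩
    (zeros (suc k) ++ y) ++ x                   ≡⟨ ++-assoc (zeros (suc k)) y x ⟩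
    zeros (suc k) ++ y ++ x                     ≡⟨ cong (_++ y ++ x) (zeros-suc k) ⟩
    zeros k ∷ʳ false ++ y ++ x                  ≡⟨ ∷ʳ-++ (zeros k) false (y ++ x) ⟩
    zeros k ++ false ∷ (y ++ x)                 ∎
    where open ≡-Reasoning

pad : ℕ → BStr → BStr
pad M w = zeros M ++ true ∷ w

module Padded (m : ℕ) (w : BStr) (w-ends : EndsInOne w) (w-free : ¬ HasZeroRun (suc m) w)
              (T<Tᴿ : (true ∷ w) <ₗ reverse (true ∷ w)) where

  private
    M : ℕ
    M = suc m
    T s : BStr
    T = true ∷ w
    s = pad M w
    -- s ≡ false ∷ tail-s holds by computation
    tail-s : BStr
    tail-s = zeros m ++ T

    Tᴿ-head : ∃ λ R → reverse T ≡ true ∷ R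
    Tᴿ-head = reverse (true ∷ proj₁ w-ends) ,
      trans (cong (λ t → reverse (true ∷ t)) (proj₂ w-ends)) (reverse-++ (true ∷ proj₁ w-ends) (true ∷ []))

  <ₗ-short-run : ∀ {c} z′ rest → c < M → s <ₗ ((zeros c ++ true ∷ z′) ++ rest)
  <ₗ-short-run {c} z′ rest c<M =
    subst (s <ₗ_) (sym (++-assoc (zeros c) (true ∷ z′) rest)) (zeros-<ₗ-zeros-one T (z′ ++ rest) c<M)

  <ₗ-rotate : ∀ i → 0 < i → i < length s → s <ₗ rotate i s
  <ₗ-rotate (suc i) _ (s≤s i<tail) with c , z′ , c<M , e ←
      suffix-short-leading-zeros (endsInOne-++ (zeros m) (endsInOne-++ (true ∷ []) w-ends))
        (¬hasZeroRun-zeros-one-++ m (n<1+n m) w-free)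
        (take i tail-s) (drop i tail-s) (sym (take++drop≡id i tail-s)) (drop-<-≢[] i tail-s i<tail)
    = subst (λ t → s <ₗ (t ++ take (suc i) s)) (sym e) (<ₗ-short-run z′ _ c<M)

  <ₗ-zeros-Tᴿ-zeros : ∀ o → o < M → s <ₗ (drop o (zeros M) ++ reverse T ++ take o (zeros M))
  <ₗ-zeros-Tᴿ-zeros zero    _   = ++-monoʳ-<ₗ (zeros M) (subst (T <ₗ_) (sym (++-identityʳ _)) T<Tᴿ)
  <ₗ-zeros-Tᴿ-zeros (suc o) o<M with R , Tᴿ≡1R ← Tᴿ-head =
    subst (s <ₗ_) (sym (cong₂ _++_ (drop-zeros (suc o) M) (cong (_++ take (suc o) (zeros M)) Tᴿ≡1R)))
      (zeros-<ₗ-zeros-one T _ (∸-monoʳ-< (s≤s z≤n) (<⇒≤ o<M)))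

  <ₗ-rotate-Tᴿ++zeros : ∀ i → i < length (reverse T ++ zeros M) → s <ₗ rotate i (reverse T ++ zeros M)
  <ₗ-rotate-Tᴿ++zeros i i<s with i <? length (reverse T)
  ... | yes i<Tᴿ with c , z′ , c<M , e ←
      suffix-short-leading-zeros (reverse w , unfold-reverse true w)
        (¬hasZeroRun-reverse T (¬hasZeroRun-zeros-one-++ 0 (s≤s z≤n) w-free))
        (take i (reverse T)) (drop i (reverse T)) (sym (take++drop≡id i _)) (drop-<-≢[] i _ i<Tᴿ)
    = subst (s <ₗ_) (sym rotation) (<ₗ-short-run z′ (zeros M ++ rest) c<M)
    where
    open ≡-Reasoning
    rest : BStr
    rest = take i (reverse T ++ zeros M)
    rotation : rotate i (reverse T ++ zeros M) ≡ (zeros c ++ true ∷ z′) ++ zeros M ++ rest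
    rotation = begin
      drop i (reverse T ++ zeros M) ++ rest       ≡⟨ cong (_++ rest) (drop-≤-++ i (reverse T) (zeros M) (<⇒≤ i<Tᴿ)) ⟩
      (drop i (reverse T) ++ zeros M) ++ rest     ≡⟨ cong (λ t → (t ++ zeros M) ++ rest) e ⟩
      ((zeros c ++ true ∷ z′) ++ zeros M) ++ rest ≡⟨ ++-assoc _ (zeros M) rest ⟩
      (zeros c ++ true ∷ z′) ++ zeros M ++ rest   ∎
  ... | no i≮Tᴿ with o , refl ← m≤n⇒∃[o]m+o≡n (≮⇒≥ i≮Tᴿ) =
    subst (s <ₗ_) (sym (rotate-length+-++ (reverse T) (zeros M) o)) (<ₗ-zeros-Tᴿ-zeros o o<M)
    where
    o<M : o < M
    o<M = +-cancelˡ-< (length (reverse T)) o M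
            (subst (length (reverse T) + o <_)
              (trans (length-++ (reverse T)) (cong (length (reverse T) +_) (length-replicate M))) i<s)

  <ₗ-rotate-reverse : ∀ i → i < length (reverse s) → s <ₗ rotate i (reverse s)
  <ₗ-rotate-reverse i i<sᴿ =
    subst (λ t → s <ₗ rotate i t) (sym reverse-s) (<ₗ-rotate-Tᴿ++zeros i (subst (i <_) (cong length reverse-s) i<sᴿ))
    where
    reverse-s : reverse s ≡ reverse T ++ zeros M
    reverse-s = trans (reverse-++ (zeros M) T) (cong (reverse T ++_) (reverse-zeros M))

  necklace : Necklace s
  necklace β (zero , _ , refl)    = inj₁ (sym (++-identityʳ s))
  necklace β (suc i , i<s , refl) = inj₂ (<ₗ-rotate (suc i) (s≤s z≤n) i<s)

  bracelet : Bracelet s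
  bracelet β (inj₁ rotation)          = necklace β rotation
  bracelet β (inj₂ (i , i<sᴿ , refl)) = inj₂ (<ₗ-rotate-reverse i i<sᴿ)

  asymmetric : ¬ Symmetric s
  asymmetric symmetric with i , i<sᴿ , e ← IsRotation-sym symmetric =
    <ₗ-irrefl (subst (s <ₗ_) (sym e) (<ₗ-rotate-reverse i i<sᴿ))

  aperiodic : Aperiodic s
  aperiodic (g , 0 , _ , () , _)
  aperiodic (g , 1 , _ , s≤s () , _)
  aperiodic (g , suc (suc j) , 0<g , _ , e) =
    <ₗ-irrefl (subst (s <ₗ_) rotation-is-s (<ₗ-rotate (length g) 0<g g<s))
    where
    open ≡-Reasoning
    rotation-is-s : rotate (length g) s ≡ s
    rotation-is-s = begin
      rotate (length g) s                 ≡⟨ cong (rotate (length g)) e ⟩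
      rotate (length g) (g ++ g ^ suc j)  ≡⟨ rotate-length-++ g _ ⟩
      g ^ suc j ++ g                      ≡⟨ ^-comm g (suc j) ⟩
      g ++ g ^ suc j                      ≡⟨ e ⟨
      s                                   ∎
    g<s : length g < length s
    g<s = subst (length g <_) (sym (trans (cong length e) (length-++ g)))
            (m<m+n (length g) (<-≤-trans 0<g (length-++-≤ˡ g)))

power-symmetric : ∀ x y j → length x < length (x ++ y) → reverse (x ++ y) ≡ y ++ x →
  Symmetric ((x ++ y) ^ suc j)
power-symmetric x y j x<xy rev = length x , <-≤-trans x<xy (length-++-≤ˡ (x ++ y)) , rotation
  where
  open ≡-Reasoning
  rotation : reverse ((x ++ y) ^ suc j) ≡ rotate (length x) ((x ++ y) ^ suc j)
  rotation = begin
    reverse ((x ++ y) ^ suc j)                 ≡⟨ reverse-^ (x ++ y) (suc j) ⟩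
    reverse (x ++ y) ^ suc j                   ≡⟨ cong (_^ suc j) rev ⟩
    (y ++ x) ^ suc j                           ≡⟨ ^-rotate y x j ⟨
    (y ++ (x ++ y) ^ j) ++ x                   ≡⟨ rotate-length-++ x _ ⟨
    rotate (length x) (x ++ y ++ (x ++ y) ^ j) ≡⟨ cong (rotate (length x)) (++-assoc x y _) ⟨
    rotate (length x) ((x ++ y) ^ suc j)       ∎

block-endsInOne : ∀ k u j → u ≢ [] → ¬ HasZeroRun (suc k) ((zeros k ++ u) ^ suc (suc j)) → EndsInOne u
block-endsInOne k u j u≢[] free with initLast u
... | []           = ⊥-elim (u≢[] refl)
... | u′ ∷ʳ′ true  = u′ , refl
... | u′ ∷ʳ′ false = ⊥-elim (free (zeros k ++ u′ , u₀ ++ R , run))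
  where
  open ≡-Reasoning
  u₀ R : BStr
  u₀ = u′ ∷ʳ false
  R = (zeros k ++ u₀) ^ j
  run : (zeros k ++ u₀) ++ (zeros k ++ u₀) ++ R ≡ (zeros k ++ u′) ++ zeros (suc k) ++ u₀ ++ R
  run = begin
    (zeros k ++ u₀) ++ (zeros k ++ u₀) ++ R        ≡⟨ ++-assoc (zeros k) u₀ _ ⟩
    zeros k ++ u₀ ++ (zeros k ++ u₀) ++ R          ≡⟨ cong (zeros k ++_) (∷ʳ-++ u′ false _) ⟩
    zeros k ++ u′ ++ false ∷ (zeros k ++ u₀) ++ R   ≡⟨ ++-assoc (zeros k) u′ _ ⟨
    (zeros k ++ u′) ++ false ∷ (zeros k ++ u₀) ++ R ≡⟨ cong (λ t → (zeros k ++ u′) ++ false ∷ t) (++-assoc (zeros k) u₀ R) ⟩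
    (zeros k ++ u′) ++ zeros (suc k) ++ u₀ ++ R     ∎

palindrome-free-length : ∀ v → EndsInOne (true ∷ v) → true ∷ v ≢ reverse (true ∷ v) → 3 ≤ length v
palindrome-free-length []                _        not-palindrome = ⊥-elim (not-palindrome refl)
palindrome-free-length (b ∷ [])          (u′ , e) not-palindrome
  with refl ← ∷ʳ-injectiveʳ (true ∷ []) u′ e = ⊥-elim (not-palindrome refl)
palindrome-free-length (b₁ ∷ b₂ ∷ [])     (u′ , e) not-palindrome
  with refl ← ∷ʳ-injectiveʳ (true ∷ b₁ ∷ []) u′ e = ⊥-elim (not-palindrome refl)
palindrome-free-length (_ ∷ _ ∷ _ ∷ _)   _        _              = s≤s (s≤s (s≤s z≤n))

one-zeros-<ₗ-reverse : ∀ k v → EndsInOne (true ∷ v) → ¬ HasZeroRun (suc k) (true ∷ v) → v ≢ [] →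
  (true ∷ zeros (suc k) ++ true ∷ v) <ₗ reverse (true ∷ zeros (suc k) ++ true ∷ v)
one-zeros-<ₗ-reverse k v (u′ , u≡u′1) free v≢[] =
  compare (suffix-short-leading-zeros (reverse v , unfold-reverse true v)
             (¬hasZeroRun-reverse (true ∷ v) free) (true ∷ []) (reverse u′) uᴿ≡1u′ᴿ u′ᴿ≢[])
  where
  open ≡-Reasoning
  uᴿ≡1u′ᴿ : reverse (true ∷ v) ≡ true ∷ reverse u′
  uᴿ≡1u′ᴿ = trans (cong reverse u≡u′1) (reverse-++ u′ (true ∷ []))
  u′ᴿ≢[] : reverse u′ ≢ []
  u′ᴿ≢[] u′ᴿ≡[] =
    v≢[] (∷-injectiveʳ (trans u≡u′1 (cong (_∷ʳ true) (reverse-injective {x = u′} {y = []} u′ᴿ≡[]))))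
  compare : (∃₂ λ c r → c < suc k × reverse u′ ≡ zeros c ++ true ∷ r) →
    (true ∷ zeros (suc k) ++ true ∷ v) <ₗ reverse (true ∷ zeros (suc k) ++ true ∷ v)
  compare (c , r , c≤k , e) =
    subst ((true ∷ zeros (suc k) ++ true ∷ v) <ₗ_) (sym reversal) (step (zeros-<ₗ-zeros-one (true ∷ v) _ c≤k))
    where
    reversal : reverse (true ∷ zeros (suc k) ++ true ∷ v)
             ≡ true ∷ zeros c ++ true ∷ (r ++ zeros (suc k)) ∷ʳ true
    reversal = begin
      reverse (true ∷ zeros (suc k) ++ true ∷ v)              ≡⟨ unfold-reverse true (zeros (suc k) ++ true ∷ v) ⟩
      reverse (zeros (suc k) ++ true ∷ v) ∷ʳ true             ≡⟨ cong (_∷ʳ true) (reverse-++ (zeros (suc k)) _) ⟩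
      (reverse (true ∷ v) ++ reverse (zeros (suc k))) ∷ʳ true ≡⟨ cong₂ (λ a b → (a ++ b) ∷ʳ true) uᴿ≡1u′ᴿ (reverse-zeros (suc k)) ⟩
      (true ∷ reverse u′ ++ zeros (suc k)) ∷ʳ true            ≡⟨ cong (λ t → (true ∷ t ++ zeros (suc k)) ∷ʳ true) e ⟩
      (true ∷ (zeros c ++ true ∷ r) ++ zeros (suc k)) ∷ʳ true ≡⟨ cong (λ t → (true ∷ t) ∷ʳ true) (++-assoc (zeros c) _ _) ⟩
      (true ∷ zeros c ++ true ∷ r ++ zeros (suc k)) ∷ʳ true   ≡⟨ cong (true ∷_) (++-assoc (zeros c) _ _) ⟩
      true ∷ zeros c ++ true ∷ (r ++ zeros (suc k)) ∷ʳ true   ∎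

-- 0^M 1 0 γ with M = n − |γ| − 2, written as a successor to match Padded.
encode : ℕ → BStr → BStr
encode n γ = pad (suc (n ∸ (3 + length γ))) (false ∷ γ)

length-encode : ∀ n γ → 3 + length γ ≤ n → length (encode n γ) ≡ n
length-encode n γ fits = begin
  length (zeros (suc m) ++ true ∷ false ∷ γ) ≡⟨ length-++ (zeros (suc m)) ⟩
  length (zeros (suc m)) + (2 + length γ)    ≡⟨ cong (_+ (2 + length γ)) (length-replicate (suc m)) ⟩
  suc m + (2 + length γ)                     ≡⟨ +-suc m (2 + length γ) ⟨
  m + (3 + length γ)                         ≡⟨ m∸n+n≡m fits ⟩
  n                                          ∎
  where
  open ≡-Reasoning
  m : ℕ
  m = n ∸ (3 + length γ)

encode-injective : ∀ n γ δ → encode n γ ≡ encode n δ → γ ≡ δ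
encode-injective n γ δ e = ∷-injectiveʳ (zeros-one-injective (suc (n ∸ (3 + length γ))) (suc (n ∸ (3 + length δ))) e)

block-fits : ∀ k L j → k + 4 ≤ L → suc k + (3 + L) ≤ suc (suc j) * L
block-fits k L j k+4≤L = begin
  suc k + (3 + L)     ≡⟨ +-suc k (3 + L) ⟨
  k + (4 + L)         ≡⟨ +-assoc k 4 L ⟨
  (k + 4) + L         ≤⟨ +-monoˡ-≤ L k+4≤L ⟩
  L + L               ≤⟨ +-monoʳ-≤ L (m≤m+n L (j * L)) ⟩
  L + (L + j * L)     ∎
  where open ≤-Reasoning

necklace-power⇒¬hasZeroRun : ∀ k v j → Necklace ((zeros k ++ true ∷ v) ^ suc j) →
  ¬ HasZeroRun (suc k) ((zeros k ++ true ∷ v) ^ suc j)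
necklace-power⇒¬hasZeroRun k v j necklace =
  subst (λ α → ¬ HasZeroRun (suc k) α) (sym α≡) (necklace⇒¬hasZeroRun k _ (subst Necklace α≡ necklace))
  where
  α≡ : (zeros k ++ true ∷ v) ^ suc j ≡ zeros k ++ true ∷ (v ++ (zeros k ++ true ∷ v) ^ j)
  α≡ = ++-assoc (zeros k) (true ∷ v) _

block-shape : ∀ {n} k v j → InA n ((zeros k ++ true ∷ v) ^ suc (suc j)) →
  ¬ HasZeroRun (suc k) (true ∷ v) × EndsInOne (true ∷ v) × 3 ≤ length v
block-shape k v j (_ , _ , necklace , asymmetric) = u-free , u-ends , palindrome-free-length v u-ends u-not-palindrome
  where
  u : BStr
  u = true ∷ v
  α-free : ¬ HasZeroRun (suc k) ((zeros k ++ u) ^ suc (suc j))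
  α-free = necklace-power⇒¬hasZeroRun k v (suc j) necklace
  u-free : ¬ HasZeroRun (suc k) u
  u-free run = α-free (subst (HasZeroRun (suc k)) (sym (++-assoc (zeros k) u _)) (hasZeroRun-infix (zeros k) u _ run))
  u-ends : EndsInOne u
  u-ends = block-endsInOne k u j (λ ()) α-free
  u-not-palindrome : u ≢ reverse u
  u-not-palindrome palindrome = asymmetric (power-symmetric (zeros k) u (suc j)
    (subst (length (zeros k) <_) (sym (length-++ (zeros k))) (m<m+n _ (s≤s z≤n)))
    (trans (reverse-++ (zeros k) u) (cong₂ _++_ (sym palindrome) (reverse-zeros k))))

encode-InA : ∀ {n} γ j → 0 < length γ → InA n (γ ^ suc (suc j)) →
  InA n (encode n γ) × Aperiodic (encode n γ)
encode-InA γ j 0<γ (_ , _ , _ , asymmetric) with leadingZeros γ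
... | all-zeros c =
  ⊥-elim (asymmetric (power-symmetric [] (zeros c) (suc j) 0<γ (trans (reverse-zeros c) (sym (++-identityʳ _)))))
encode-InA {n} _ j _ α∈A@(length-α , _) | zeros-one k v
  with u-free , u-ends , 3≤v ← block-shape k v j α∈A =
  (length-encode n γ (≤-trans (m≤n+m _ (suc k)) fits) , P.bracelet , P.necklace , P.asymmetric) , P.aperiodic
  where
  γ : BStr
  γ = zeros k ++ true ∷ v
  fits : suc k + (3 + length γ) ≤ n
  fits = subst (suc k + (3 + length γ) ≤_) (trans (sym (length-^ γ (suc (suc j)))) length-α)
           (block-fits k (length γ) j (subst (k + 4 ≤_) (sym (trans (length-++ (zeros k)) (cong (_+ _) (length-replicate k))))
              (+-monoʳ-≤ k (s≤s 3≤v))))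
  m : ℕ
  m = n ∸ (3 + length γ)
  k<m : k < m
  k<m = m+n≤o⇒m≤o∸n (suc k) fits
  v-free : ¬ HasZeroRun (suc m) v
  v-free run = u-free (hasZeroRun-≤ (s≤s (<⇒≤ k<m))
    (subst (HasZeroRun (suc m)) (cong (true ∷_) (++-identityʳ v)) (hasZeroRun-infix (true ∷ []) v [] run)))
  v≢[] : v ≢ []
  v≢[] v≡[] = contradiction (subst (λ t → 3 ≤ length t) v≡[] 3≤v) λ ()
  module P = Padded m (false ∷ γ) (endsInOne-++ (zeros (suc k)) u-ends)
                    (¬hasZeroRun-zeros-one-++ (suc k) (s≤s k<m) v-free)
                    (one-zeros-<ₗ-reverse k v u-ends u-free v≢[])

lemma4 : (n : ℕ) → 6 ≤ n → (p q : ℕ) →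
    HasCount (λ α → InA n α × Periodic α) p →
    HasCount (λ α → InA n α × Aperiodic α) q →
    p ≤ q
lemma4 n _ p q = HasCount-≤ code code-InA code-injective
  where
  code : ∀ α → InA n α × Periodic α → BStr
  code _ (_ , γ , _) = encode n γ
  code-InA : ∀ α a → InA n (code α a) × Aperiodic (code α a)
  code-InA _ (_ , γ , 0 , _ , () , _)
  code-InA _ (_ , γ , 1 , _ , s≤s () , _)
  code-InA _ (α∈A , γ , suc (suc j) , 0<γ , _ , refl) = encode-InA γ j 0<γ α∈A
  code-injective : ∀ {α β} a b → code α a ≡ code β b → α ≡ β
  code-injective (α∈A , γ , i , 0<γ , _ , refl) (β∈A , δ , j , _ , _ , refl) e
    with refl ← encode-injective n γ δ e =
    cong (γ ^_) (^-cancel-length γ i j 0<γ (trans (proj₁ α∈A) (sym (proj₁ β∈A))))
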